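{- Let $n\ge 2$, $0<\varepsilon<1/n^4$, and let $\mathcal{P}'$ be any deterministic cuts-only primitive protocol. Consider the following randomized adversary answering the queries of $\mathcal{P}'$: first choose a permutation $\pi$ of $\{1,\dots,n\}$ uniformly at random; when $\mathcal{P}'$ issues $\mathrm{Cut}(p,i/n)$ and $x_{p,i}$ has not yet been fixed, fix $x_{p,i}$ uniformly at random among the points of $X_i$ not yet assigned to another player at level $i$ that are admissible for $p$ (the $i$-th point of $X_i$ if $\pi(p)=i$; one of the first $i-1$ points if $\pi(p)<i$; one of the last $n-i$ points if $\pi(p)>i$), and return it; when $\mathcal{P}'$ terminates, fix all remaining $x_{p,i}$ one at a time by the same uniform rule. Then the resulting instance is distributed according to $\mathcal{D}$, the uniform distribution on $\mathcal{J}$.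
   Context: The cake is $[0,1]$, with $n$ players $p\in\{1,\dots,n\}$. For $i\in\{1,\dots,n\}$ let $X_i=\{\,i/(n+1)+k\varepsilon : k=1,\dots,n\,\}$, and call $i/(n+1)+k\varepsilon$ the $k$-th point of $X_i$. A WS instance is specified by points $x_{p,i}\in X_i$ ($p,i\in\{1,\dots,n\}$) such that for each $i$ the map $p\mapsto x_{p,i}$ is a bijection from $\{1,\dots,n\}$ onto $X_i$. In this instance, player $p$'s measure $\mu_p$ is the measure on $[0,1]$ that puts mass $1/(n+1)$ uniformly on $[0,\varepsilon/2]$ and, for each $i\in\{1,\dots,n\}$, mass $i/(n^2+n)$ uniformly on $[x_{p,i}-\varepsilon/2,\,x_{p,i}]$ and mass $(n-i)/(n^2+n)$ uniformly on $[x_{p,i},\,x_{p,i}+\varepsilon/2]$, and no other mass; the $i/n$-point of $p$ (infimum of $x$ with $\mu_p([0,x])=i/n$) is then $x_{p,i}$. The query $\mathrm{Cut}(p,\alpha)$ returns the $\alpha$-point of $p$. A deterministic protocol issues queries adaptively and terminates by assigning each player a single interval. It is primitive if all its Cut queries are of the form $\mathrm{Cut}(p,i/n)$, $i\in\{1,\dots,n\}$, and cuts-only if it makes no evaluation queries. For a permutation $\pi$ of $\{1,\dots,n\}$, let $\mathcal{J}_\pi$ be the set of WS instances such that for all $p,i$: if $\pi(p)=i$ then $x_{p,i}$ is the $i$-th point of $X_i$; if $\pi(p)<i$ then $x_{p,i}$ is one of the first $i-1$ points of $X_i$; if $\pi(p)>i$ then $x_{p,i}$ is one of the last $n-i$ points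 of $X_i$. Let $\mathcal{J}=\bigcup_\pi\mathcal{J}_\pi$ and $\mathcal{D}$ the uniform distribution on the finite set $\mathcal{J}$. -}

module Defs where

open import Data.Nat as ℕ using (ℕ; zero; suc; _^_)
open import Data.Integer using (+_)
open import Data.Rational as ℚ using (ℚ; _/_; 0ℚ; 1ℚ)
open import Data.Fin using (Fin; zero; suc; toℕ)
open import Data.Fin.Properties using (all?; any?) renaming (_≟_ to _≟ᶠ_)
open import Data.List using (List; []; _∷_; [_]; map; concatMap; filter; length; foldr)
open import Data.List.Base using (allFin)
open import Data.Maybe using (Maybe; just; nothing)
import Data.Maybe.Properties as MaybeP
open import Data.Product using (_×_; _,_; ∃)
open import Data.Sum using (_⊎_)
open import Relation.Nullary using (Dec; yes; no; does)
open import Relation.Nullary.Decidable using (_×-dec_; _⊎-dec_; _→-dec_)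
open import Relation.Binary.PropositionalEquality using (_≡_)
open import Data.Bool using (if_then_else_)

-- Conventions (0-based indexing).
--   player p ∈ {1..n}           ↦  p : Fin n   (player toℕ p + 1)
--   level  i ∈ {1..n}           ↦  i : Fin n   (level  toℕ i + 1)
--   k-th point of X_i, k∈{1..n} ↦  k : Fin n   (point  toℕ k + 1)
-- A WS instance is determined by the indices of the points x_{p,i}:
--   x p i = k  means  x_{p,i} is the k-th point of X_i.

Points : ℕ → Set
Points n = Fin n → Fin n → Fin n

IsBijection : {n : ℕ} → (Fin n → Fin n) → Set
IsBijection {n} f = (∀ p q → f p ≡ f q → p ≡ q) × (∀ k → ∃ λ p → f p ≡ k)

IsWSInstance : {n : ℕ} → Points n → Set
IsWSInstance x = ∀ i → IsBijection (λ p → x p i)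

IsPermutation : {n : ℕ} → (Fin n → Fin n) → Set
IsPermutation = IsBijection

Admissible : {n : ℕ} → (Fin n → Fin n) → Fin n → Fin n → Fin n → Set
Admissible π p i k =
  (toℕ (π p) ≡ toℕ i × toℕ k ≡ toℕ i)
  ⊎ (toℕ (π p) ℕ.< toℕ i × toℕ k ℕ.< toℕ i)
  ⊎ (toℕ i ℕ.< toℕ (π p) × toℕ i ℕ.< toℕ k)

InJπ : {n : ℕ} → (Fin n → Fin n) → Points n → Set
InJπ π x = ∀ p i → Admissible π p i (x p i)

isBijection? : {n : ℕ} → (f : Fin n → Fin n) → Dec (IsBijection f)
isBijection? f =
  all? (λ p → all? (λ q → (f p ≟ᶠ f q) →-dec (p ≟ᶠ q)))
  ×-dec all? (λ k → any? (λ p → f p ≟ᶠ k))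

isWSInstance? : {n : ℕ} → (x : Points n) → Dec (IsWSInstance x)
isWSInstance? x = all? (λ i → isBijection? (λ p → x p i))

admissible? : {n : ℕ} (π : Fin n → Fin n) (p i k : Fin n) → Dec (Admissible π p i k)
admissible? π p i k =
  ((toℕ (π p) ℕ.≟ toℕ i) ×-dec (toℕ k ℕ.≟ toℕ i))
  ⊎-dec ((toℕ (π p) ℕ.<? toℕ i) ×-dec (toℕ k ℕ.<? toℕ i))
  ⊎-dec ((toℕ i ℕ.<? toℕ (π p)) ×-dec (toℕ i ℕ.<? toℕ k))

inJπ? : {n : ℕ} (π : Fin n → Fin n) (x : Points n) → Dec (InJπ π x)
inJπ? π x = all? (λ p → all? (λ i → admissible? π p i (x p i)))

allFuns : {B : Set} → List B → (m : ℕ) → List (Fin m → B)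
allFuns bs zero = [ (λ ()) ]
allFuns bs (suc m) =
  concatMap (λ b → map (λ f → λ { zero → b ; (suc j) → f j }) (allFuns bs m)) bs

allPerms : (n : ℕ) → List (Fin n → Fin n)
allPerms n = filter isBijection? (allFuns (allFin n) n)

InJ : {n : ℕ} → Points n → Set
InJ {n} x = IsWSInstance x × Data.List.Relation.Unary.Any.Any (λ π → InJπ π x) (allPerms n)
  where import Data.List.Relation.Unary.Any

inJ? : {n : ℕ} (x : Points n) → Dec (InJ x)
inJ? {n} x = isWSInstance? x ×-dec Data.List.Relation.Unary.Any.any? (λ π → inJπ? π x) (allPerms n)
  where import Data.List.Relation.Unary.Any

allJ : (n : ℕ) → List (Points n)
allJ n = filter inJ? (allFuns (allFuns (allFin n) n) n)

Dist : Set → Set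
Dist A = List (ℚ × A)

return : {A : Set} → A → Dist A
return a = [ (1ℚ , a) ]

_>>=_ : {A B : Set} → Dist A → (A → Dist B) → Dist B
d >>= f = concatMap (λ { (w , a) → map (λ { (v , b) → (w ℚ.* v , b) }) (f a) }) d

-- uniform distribution on the elements of a list (empty list: no mass)
uniform : {A : Set} → List A → Dist A
uniform [] = []
uniform (a ∷ as) = map (λ b → (+ 1 / suc (length as) , b)) (a ∷ as)

Pr : {A : Set} {P : A → Set} → Dist A → ((a : A) → Dec (P a)) → ℚ
Pr d P? = foldr (λ { (w , a) acc → if does (P? a) then w ℚ.+ acc else acc }) 0ℚ d

𝒟 : (n : ℕ) → Dist (Points n)
𝒟 n = uniform (allJ n)

-- Deterministic, cuts-only, primitive protocols (decision trees).
-- cut p i κ : query Cut(p, (i+1)/n), whose answer (on a WS instance) is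
-- x_{p,i}, the (k+1)-th point of X_{i+1}; continue with κ k.
-- done r : terminate with the allocation r (of arbitrary type R).

data Protocol (n : ℕ) (R : Set) : Set where
  done : R → Protocol n R
  cut  : (p i : Fin n) → (Fin n → Protocol n R) → Protocol n R

-- partially fixed instance: s p i = just k iff x_{p,i} fixed to k-th point
State : ℕ → Set
State n = Fin n → Fin n → Maybe (Fin n)

emptyState : {n : ℕ} → State n
emptyState _ _ = nothing

update : {n : ℕ} → State n → Fin n → Fin n → Fin n → State n
update s p i k q j with q ≟ᶠ p | j ≟ᶠ i
... | yes _ | yes _ = just k
... | _     | _     = s q j

Free : {n : ℕ} → State n → Fin n → Fin n → Set
Free s i k = ∀ q → (s q i ≡ just k → Data.Empty.⊥)
  where import Data.Empty

free? : {n : ℕ} (s : State n) (i k : Fin n) → Dec (Free s i k)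
free? s i k = all? (λ q → MaybeP.≡-dec _≟ᶠ_ (s q i) (just k) →-dec no (λ ()))

candidates : {n : ℕ} → (Fin n → Fin n) → State n → Fin n → Fin n → List (Fin n)
candidates {n} π s p i = filter (λ k → free? s i k ×-dec admissible? π p i k) (allFin n)

fix : {n : ℕ} → (Fin n → Fin n) → State n → Fin n → Fin n → Dist (State n × Fin n)
fix π s p i with s p i
... | just k  = return (s , k)
... | nothing = uniform (candidates π s p i) >>= λ k → return (update s p i k , k)

allPairs : (n : ℕ) → List (Fin n × Fin n)
allPairs n = concatMap (λ i → map (λ p → (p , i)) (allFin n)) (allFin n)

fillAll : {n : ℕ} → (Fin n → Fin n) → List (Fin n × Fin n) → State n → Dist (State n)
fillAll π [] s = return s
fillAll π ((p , i) ∷ ps) s = fix π s p i >>= λ { (s' , _) → fillAll π ps s' }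

run : {n : ℕ} {R : Set} → (Fin n → Fin n) → State n → Protocol n R → Dist (State n)
run {n} π s (done r) = fillAll π (allPairs n) s
run π s (cut p i κ) = fix π s p i >>= λ { (s' , k) → run π s' (κ k) }

adversary : {n : ℕ} {R : Set} → Protocol n R → Dist (State n)
adversary {n} P = uniform (allPerms n) >>= λ π → run π emptyState P

Is : {n : ℕ} → Points n → State n → Set
Is x s = ∀ p i → s p i ≡ just (x p i)

is? : {n : ℕ} (x : Points n) (s : State n) → Dec (Is x s)
is? x s = all? (λ p → all? (λ i → MaybeP.≡-dec _≟ᶠ_ (s p i) (just (x p i))))

_≟ᴾ_ : {n : ℕ} (y x : Points n) → Dec (∀ p i → y p i ≡ x p i)
y ≟ᴾ x = all? (λ p → all? (λ i → y p i ≟ᶠ x p i))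

-- For a fixed permutation π the adversary only reaches partial instances that extend to an instance
-- of 𝒥_π: if a free point k is admissible for p at level i and q holds k in some completion, swapping
-- p and q at level i gives another completion. Let the weight of a partial instance be the product,
-- over the levels j and the three sides of j, of (number of free points of that side at level j)!.
-- Fixing x_{p,i} chooses uniformly among exactly as many candidates as the factor by which the weight
-- drops, and complete instances have weight 1, so every x ∈ 𝒥_π is produced with probability
-- 1 / weight ∅, the same for all x and π. As every x ∈ 𝒥 lies in 𝒥_π for exactly one π, averaging
-- over π gives all of 𝒥 the same probability, and instances outside 𝒥 never occur.
module Submission where

open import Defs
open import Algebra.Bundles using (CommutativeMonoid)
import Algebra.Properties.CommutativeMonoid.Sum as CommutativeMonoidSum
open import Data.Empty using (⊥-elim)
open import Data.Fin using (Fin; zero; suc; toℕ; punchIn)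
open import Data.Fin.Permutation.Components using (transpose; transpose-inverse)
open import Data.Fin.Properties using (_≟_; toℕ-injective; punchInᵢ≢i; all?)
open import Data.Integer as ℤ using (+_)
open import Data.Integer.Tactic.RingSolver using (solve-∀)
open import Data.List using (List; []; _∷_; [_]; _++_; map; filter; length; concatMap; allFin; tabulate)
open import Data.List.Properties using (filter-≐; filter-++; length-++; filter-none; filter-accept; filter-reject; concatMap-pure; map-cong)
open import Data.List.Relation.Unary.All using (universal)
open import Data.List.Membership.Propositional using (_∈_; lose; find)
open import Data.List.Membership.Propositional.Properties using (∈-filter⁺; ∈-filter⁻; ∈-allFin; ∈-map⁺; ∈-concat⁺′)
open import Data.List.Relation.Unary.Any as Any using (here; there)
open import Data.Maybe using (just; nothing)
open import Data.Maybe.Properties using (just-injective)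
open import Data.Nat as ℕ using (ℕ; zero; suc; _!; _≤_; _^_)
import Data.Nat.Properties as ℕ
import Data.Nat.ListAction as ℕ
open import Data.Product as Product using (_×_; _,_; proj₁; proj₂; ∃)
open import Data.Sum using (_⊎_; inj₁; inj₂)
open import Data.Vec.Functional using (removeAt)
open import Data.Rational as ℚ using (ℚ; _/_; 0ℚ; 1ℚ; _+_; _*_; _<_; toℚᵘ)
import Data.Rational.Properties as ℚ
import Data.Rational.Unnormalised as ℚᵘ
import Data.Rational.Unnormalised.Properties as ℚᵘ
open import Function using (_∘_; id)
open import Relation.Binary.PropositionalEquality using (_≡_; _≢_; refl; sym; trans; cong; cong₂; subst; module ≡-Reasoning)
open import Relation.Binary.Definitions using (tri<; tri≈; tri>)
open import Relation.Nullary using (Dec; yes; no; ¬_)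
open import Relation.Nullary.Decidable using (dec-true; dec-false; _×-dec_)
open import Relation.Unary using (Decidable; _⊆_; _≐_)

private variable
  A B : Set

ι : ℕ → ℚ
ι m = + m / 1

private
  toℚᵘ-ι : ∀ m → toℚᵘ (ι m) ℚᵘ.≃ ℚᵘ.mkℚᵘ (+ m) 0
  toℚᵘ-ι m = ℚ.toℚᵘ-fromℚᵘ (ℚᵘ.mkℚᵘ (+ m) 0)

module _ where
  open import Relation.Binary.Reasoning.Setoid ℚᵘ.≃-setoid

  ι-suc : ∀ m → ι (suc m) ≡ 1ℚ + ι m
  ι-suc m = ℚ.toℚᵘ-injective (begin
    toℚᵘ (ι (suc m))             ≈⟨ toℚᵘ-ι (suc m) ⟩
    ℚᵘ.mkℚᵘ (+ suc m) 0          ≈⟨ ℚᵘ.*≡* (cross (+ m)) ⟩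
    ℚᵘ.1ℚᵘ ℚᵘ.+ ℚᵘ.mkℚᵘ (+ m) 0  ≈⟨ ℚᵘ.+-congʳ ℚᵘ.1ℚᵘ (toℚᵘ-ι m) ⟨
    toℚᵘ 1ℚ ℚᵘ.+ toℚᵘ (ι m)      ≈⟨ ℚ.toℚᵘ-homo-+ 1ℚ (ι m) ⟨
    toℚᵘ (1ℚ + ι m)              ∎)
    where
    cross : ∀ a → (ℤ.1ℤ ℤ.+ a) ℤ.* ℤ.1ℤ ≡ (ℤ.1ℤ ℤ.+ a ℤ.* ℤ.1ℤ) ℤ.* ℤ.1ℤ
    cross = solve-∀

  ι-* : ∀ m k → ι (m ℕ.* k) ≡ ι m * ι k
  ι-* m k = ℚ.toℚᵘ-injective (begin
    toℚᵘ (ι (m ℕ.* k))                    ≈⟨ toℚᵘ-ι (m ℕ.* k) ⟩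
    ℚᵘ.mkℚᵘ (+ (m ℕ.* k)) 0               ≈⟨ ℚᵘ.*≡* (cong (ℤ._* ℤ.1ℤ) (ℤ.pos-* m k)) ⟩
    ℚᵘ.mkℚᵘ (+ m) 0 ℚᵘ.* ℚᵘ.mkℚᵘ (+ k) 0  ≈⟨ ℚᵘ.*-cong (toℚᵘ-ι m) (toℚᵘ-ι k) ⟨
    toℚᵘ (ι m) ℚᵘ.* toℚᵘ (ι k)            ≈⟨ ℚ.toℚᵘ-homo-* (ι m) (ι k) ⟨
    toℚᵘ (ι m * ι k)                      ∎)
    where import Data.Integer.Properties as ℤ

  1/suc-*-ι : ∀ m → + 1 / suc m * ι (suc m) ≡ 1ℚ
  1/suc-*-ι m = ℚ.toℚᵘ-injective (begin
    toℚᵘ (+ 1 / suc m * ι (suc m))            ≈⟨ ℚ.toℚᵘ-homo-* (+ 1 / suc m) (ι (suc m)) ⟩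
    toℚᵘ (+ 1 / suc m) ℚᵘ.* toℚᵘ (ι (suc m))  ≈⟨ ℚᵘ.*-cong (ℚ.toℚᵘ-fromℚᵘ (ℚᵘ.mkℚᵘ (+ 1) m)) (toℚᵘ-ι (suc m)) ⟩
    ℚᵘ.mkℚᵘ (+ 1) m ℚᵘ.* ℚᵘ.mkℚᵘ (+ suc m) 0  ≈⟨ ℚᵘ.*≡* (cross (+ suc m)) ⟩
    ℚᵘ.1ℚᵘ                                    ∎)
    where
    cross : ∀ a → (ℤ.1ℤ ℤ.* a) ℤ.* ℤ.1ℤ ≡ ℤ.1ℤ ℤ.* (a ℤ.* ℤ.1ℤ)
    cross = solve-∀

*-inverse-unique : ∀ a {b c} → a * b ≡ 1ℚ → a * c ≡ 1ℚ → b ≡ c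
*-inverse-unique a {b} {c} ab≡1 ac≡1 = begin
  b            ≡⟨ ℚ.*-identityˡ b ⟨
  1ℚ * b       ≡⟨ cong (_* b) ac≡1 ⟨
  a * c * b    ≡⟨ cong (_* b) (ℚ.*-comm a c) ⟩
  c * a * b    ≡⟨ ℚ.*-assoc c a b ⟩
  c * (a * b)  ≡⟨ cong (c *_) ab≡1 ⟩
  c * 1ℚ       ≡⟨ ℚ.*-identityʳ c ⟩
  c            ∎
  where open ≡-Reasoning

count : {P : A → Set} → Decidable P → List A → ℕ
count P? = length ∘ filter P?

module _ {P : A → Set} (P? : Decidable P) where

  count-++ : ∀ xs ys → count P? (xs ++ ys) ≡ count P? xs ℕ.+ count P? ys
  count-++ xs ys = trans (cong length (filter-++ P? xs ys)) (length-++ (filter P? xs))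

  count-concatMap : (F : B → List A) → ∀ xs → count P? (concatMap F xs) ≡ ℕ.sum (map (count P? ∘ F) xs)
  count-concatMap F []       = refl
  count-concatMap F (x ∷ xs) = trans (count-++ (F x) (concatMap F xs)) (cong (count P? (F x) ℕ.+_) (count-concatMap F xs))

  count-as-sum : ∀ xs → count P? xs ≡ ℕ.sum (map (λ x → count P? [ x ]) xs)
  count-as-sum xs = trans (cong (count P?) (sym (concatMap-pure xs))) (count-concatMap [_] xs)

  count-map : (f : B → A) → ∀ xs → count P? (map f xs) ≡ count (P? ∘ f) xs
  count-map f []       = refl
  count-map f (x ∷ xs) with P? (f x)
  ... | yes _ = cong suc (count-map f xs)
  ... | no _  = count-map f xs

  count-none : (∀ x → ¬ P x) → ∀ xs → count P? xs ≡ 0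
  count-none ¬P xs = cong length (filter-none P? (universal ¬P xs))

  count-[]-yes : ∀ {x} → P x → count P? [ x ] ≡ 1
  count-[]-yes Px = cong length (filter-accept P? Px)

  count-[]-no : ∀ {x} → ¬ P x → count P? [ x ] ≡ 0
  count-[]-no ¬Px = cong length (filter-reject P? ¬Px)

module _ {P Q : A → Set} (P? : Decidable P) (Q? : Decidable Q) where

  count-≐ : P ≐ Q → ∀ xs → count P? xs ≡ count Q? xs
  count-≐ P≐Q xs = cong length (filter-≐ P? Q? P≐Q xs)

  count-filter : Q ⊆ P → ∀ xs → count Q? (filter P? xs) ≡ count Q? xs
  count-filter Q⊆P [] = refl
  count-filter Q⊆P (x ∷ xs) with P? x
  ... | no ¬Px = trans (count-filter Q⊆P xs) (sym (cong length (filter-reject Q? (¬Px ∘ Q⊆P))))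
  ... | yes _ with Q? x
  ...   | yes _ = cong suc (count-filter Q⊆P xs)
  ...   | no _  = count-filter Q⊆P xs

module _ {c ℓ} (M : CommutativeMonoid c ℓ) where
  open CommutativeMonoid M
  open CommutativeMonoidSum M using (sum; sum-remove; sum-cong-≋)
  open import Relation.Binary.Reasoning.Setoid setoid

  sum-scaleAt : ∀ {n} (f g : Fin n → Carrier) (i : Fin n) (a : Carrier) →
    f i ≈ a ∙ g i → (∀ j → j ≢ i → f j ≈ g j) → sum f ≈ a ∙ sum g
  sum-scaleAt {suc n} f g i a fi≈agi fj≈gj = begin
    sum f                           ≈⟨ sum-remove {i = i} f ⟩
    f i ∙ sum (removeAt f i)        ≈⟨ ∙-cong fi≈agi (sum-cong-≋ λ j → fj≈gj (punchIn i j) (punchInᵢ≢i i j)) ⟩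
    (a ∙ g i) ∙ sum (removeAt g i)  ≈⟨ assoc a (g i) _ ⟩
    a ∙ (g i ∙ sum (removeAt g i))  ≈⟨ ∙-congˡ (sum-remove {i = i} g) ⟨
    a ∙ sum g                       ∎

module ℕ+ = CommutativeMonoidSum ℕ.+-0-commutativeMonoid
module ℕ* = CommutativeMonoidSum ℕ.*-1-commutativeMonoid

module _ {n : ℕ} {P Q : Fin n → Set} (P? : Decidable P) (Q? : Decidable Q) where

  private
    count-allFin : {R : Fin n → Set} (R? : Decidable R) → count R? (allFin n) ≡ ℕ+.sum (λ k → count R? [ k ])
    count-allFin R? = count-tabulate n (λ k → k)
      where
      count-tabulate : ∀ m (f : Fin m → Fin n) → count R? (tabulate f) ≡ ℕ+.sum (λ k → count R? [ f k ])
      count-tabulate zero    f = refl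
      count-tabulate (suc m) f with R? (f zero)
      ... | yes _ = cong suc (count-tabulate m (f ∘ suc))
      ... | no _  = count-tabulate m (f ∘ suc)

    count-[]-⇔ : ∀ {k} → (P k → Q k) → (Q k → P k) → count P? [ k ] ≡ count Q? [ k ]
    count-[]-⇔ {k} to from with P? k
    ... | yes Pk  = sym (count-[]-yes Q? (to Pk))
    ... | no ¬Pk  = sym (count-[]-no Q? (¬Pk ∘ from))

  count-allFin-dropAt : (k₀ : Fin n) → P k₀ → ¬ Q k₀ →
    (∀ k → k ≢ k₀ → P k → Q k) → (∀ k → k ≢ k₀ → Q k → P k) →
    count P? (allFin n) ≡ suc (count Q? (allFin n))
  count-allFin-dropAt k₀ Pk₀ ¬Qk₀ to from = begin
    count P? (allFin n)                ≡⟨ count-allFin P? ⟩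
    ℕ+.sum (λ k → count P? [ k ])      ≡⟨ sum-scaleAt ℕ.+-0-commutativeMonoid _ _ k₀ 1 at₀ elsewhere ⟩
    suc (ℕ+.sum (λ k → count Q? [ k ])) ≡⟨ cong suc (count-allFin Q?) ⟨
    suc (count Q? (allFin n))          ∎
    where
    open ≡-Reasoning
    at₀ : count P? [ k₀ ] ≡ suc (count Q? [ k₀ ])
    at₀ = trans (count-[]-yes P? Pk₀) (cong suc (sym (count-[]-no Q? ¬Qk₀)))
    elsewhere : ∀ k → k ≢ k₀ → count P? [ k ] ≡ count Q? [ k ]
    elsewhere k k≢k₀ = count-[]-⇔ (to k k≢k₀) (from k k≢k₀)

count-≟-allFin : ∀ {n} (k₀ : Fin n) → count (_≟ k₀) (allFin n) ≡ 1
count-≟-allFin {n} k₀ = trans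
  (count-allFin-dropAt (_≟ k₀) (λ _ → no (λ ())) k₀ refl (λ ()) (λ k k≢k₀ k≡k₀ → k≢k₀ k≡k₀) (λ _ _ ()))
  (cong suc (count-none (λ _ → no (λ ())) (λ _ ()) (allFin n)))

∑ : (A → ℚ) → List A → ℚ
∑ f []       = 0ℚ
∑ f (x ∷ xs) = f x + ∑ f xs

𝟙 : {P : Set} → Dec P → ℚ
𝟙 (yes _) = 1ℚ
𝟙 (no _)  = 0ℚ

𝟙-yes : {P : Set} (P? : Dec P) → P → 𝟙 P? ≡ 1ℚ
𝟙-yes (yes _) _ = refl
𝟙-yes (no ¬p) p = ⊥-elim (¬p p)

𝟙-no : {P : Set} (P? : Dec P) → ¬ P → 𝟙 P? ≡ 0ℚ
𝟙-no (yes p) ¬p = ⊥-elim (¬p p)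
𝟙-no (no _)  _  = refl

∑-cong : {f g : A → ℚ} → (∀ x → f x ≡ g x) → ∀ xs → ∑ f xs ≡ ∑ g xs
∑-cong f≗g []       = refl
∑-cong f≗g (x ∷ xs) = cong₂ _+_ (f≗g x) (∑-cong f≗g xs)

∑-const : (f : A → ℚ) {c : ℚ} → ∀ xs → (∀ {x} → x ∈ xs → f x ≡ c) → ∑ f xs ≡ ι (length xs) * c
∑-const f {c} []       _     = sym (ℚ.*-zeroˡ c)
∑-const f {c} (x ∷ xs) f≡c = begin
  f x + ∑ f xs               ≡⟨ cong₂ _+_ (f≡c (here refl)) (∑-const f xs (f≡c ∘ there)) ⟩
  c + ι (length xs) * c      ≡⟨ cong (_+ ι (length xs) * c) (ℚ.*-identityˡ c) ⟨
  1ℚ * c + ι (length xs) * c ≡⟨ ℚ.*-distribʳ-+ c 1ℚ (ι (length xs)) ⟨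
  (1ℚ + ι (length xs)) * c   ≡⟨ cong (_* c) (ι-suc (length xs)) ⟨
  ι (suc (length xs)) * c    ∎
  where open ≡-Reasoning

*-∑≡count : {P : A → Set} (P? : Decidable P) (w : ℚ) (f : A → ℚ) → ∀ xs →
  (∀ {x} → x ∈ xs → P x → w * f x ≡ 1ℚ) → (∀ {x} → x ∈ xs → ¬ P x → f x ≡ 0ℚ) →
  w * ∑ f xs ≡ ι (count P? xs)
*-∑≡count P? w f []       _   _   = ℚ.*-zeroʳ w
*-∑≡count P? w f (x ∷ xs) hit miss with P? x
... | yes Px = begin
  w * (f x + ∑ f xs)       ≡⟨ ℚ.*-distribˡ-+ w (f x) (∑ f xs) ⟩
  w * f x + w * ∑ f xs     ≡⟨ cong₂ _+_ (hit (here refl) Px) rest ⟩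
  1ℚ + ι (count P? xs)     ≡⟨ ι-suc (count P? xs) ⟨
  ι (suc (count P? xs))    ∎
  where
  open ≡-Reasoning
  rest = *-∑≡count P? w f xs (hit ∘ there) (miss ∘ there)
... | no ¬Px = begin
  w * (f x + ∑ f xs)       ≡⟨ ℚ.*-distribˡ-+ w (f x) (∑ f xs) ⟩
  w * f x + w * ∑ f xs     ≡⟨ cong₂ _+_ (cong (w *_) (miss (here refl) ¬Px)) rest ⟩
  w * 0ℚ + ι (count P? xs) ≡⟨ cong (_+ ι (count P? xs)) (ℚ.*-zeroʳ w) ⟩
  0ℚ + ι (count P? xs)     ≡⟨ ℚ.+-identityˡ _ ⟩
  ι (count P? xs)          ∎
  where
  open ≡-Reasoning
  rest = *-∑≡count P? w f xs (hit ∘ there) (miss ∘ there)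

∑-𝟙 : {P : A → Set} (P? : Decidable P) → ∀ xs → ∑ (𝟙 ∘ P?) xs ≡ ι (count P? xs)
∑-𝟙 P? xs = trans (sym (ℚ.*-identityˡ _))
  (*-∑≡count P? 1ℚ (𝟙 ∘ P?) xs (λ {x} _ Px → trans (ℚ.*-identityˡ _) (𝟙-yes (P? x) Px)) (λ {x} _ → 𝟙-no (P? x)))

𝔼 : Dist A → (A → ℚ) → ℚ
𝔼 []            f = 0ℚ
𝔼 ((w , x) ∷ d) f = w * f x + 𝔼 d f

Pr≡𝔼 : {P : A → Set} (d : Dist A) (P? : Decidable P) → Pr d P? ≡ 𝔼 d (𝟙 ∘ P?)
Pr≡𝔼 []            P? = refl
Pr≡𝔼 ((w , x) ∷ d) P? with P? x
... | yes _ = cong₂ _+_ (sym (ℚ.*-identityʳ w)) (Pr≡𝔼 d P?)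
... | no _  = trans (Pr≡𝔼 d P?) (sym (trans (cong (_+ 𝔼 d _) (ℚ.*-zeroʳ w)) (ℚ.+-identityˡ _)))

𝔼-cong : (d : Dist A) {f g : A → ℚ} → (∀ x → f x ≡ g x) → 𝔼 d f ≡ 𝔼 d g
𝔼-cong []            f≗g = refl
𝔼-cong ((w , x) ∷ d) f≗g = cong₂ _+_ (cong (w *_) (f≗g x)) (𝔼-cong d f≗g)

𝔼-return : (x : A) (f : A → ℚ) → 𝔼 (return x) f ≡ f x
𝔼-return x f = trans (ℚ.+-identityʳ _) (ℚ.*-identityˡ _)

𝔼-++ : (d e : Dist A) (f : A → ℚ) → 𝔼 (d ++ e) f ≡ 𝔼 d f + 𝔼 e f
𝔼-++ []            e f = sym (ℚ.+-identityˡ _)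
𝔼-++ ((w , x) ∷ d) e f = trans (cong (_+_ (w * f x)) (𝔼-++ d e f)) (sym (ℚ.+-assoc (w * f x) (𝔼 d f) (𝔼 e f)))

-- The rescaling is an argument because the one in _>>=_ is a pattern-matching lambda, which cannot be named.
𝔼-rescale : (w : ℚ) (h : ℚ × A → ℚ × A) → (∀ v x → h (v , x) ≡ (w * v , x)) →
  (d : Dist A) (f : A → ℚ) → 𝔼 (map h d) f ≡ w * 𝔼 d f
𝔼-rescale w h h≡ []            f = sym (ℚ.*-zeroʳ w)
𝔼-rescale w h h≡ ((v , x) ∷ d) f rewrite h≡ v x =
  trans (cong₂ _+_ (ℚ.*-assoc w v (f x)) (𝔼-rescale w h h≡ d f)) (sym (ℚ.*-distribˡ-+ w _ _))

𝔼->>= : (d : Dist A) (k : A → Dist B) (f : B → ℚ) → 𝔼 (d >>= k) f ≡ 𝔼 d (λ x → 𝔼 (k x) f)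
𝔼->>= []            k f = refl
𝔼->>= ((w , x) ∷ d) k f =
  trans (𝔼-++ (map _ (k x)) (d >>= k) f) (cong₂ _+_ (𝔼-rescale w _ (λ _ _ → refl) (k x) f) (𝔼->>= d k f))

𝔼-∑ : (d : Dist A) (f : B → A → ℚ) (ys : List B) → ∑ (λ y → 𝔼 d (f y)) ys ≡ 𝔼 d (λ x → ∑ (λ y → f y x) ys)
𝔼-∑ d f []       = sym (𝔼-zero d)
  where
  𝔼-zero : (d : Dist A) → 𝔼 d (λ _ → 0ℚ) ≡ 0ℚ
  𝔼-zero []            = refl
  𝔼-zero ((w , _) ∷ d) = trans (cong₂ _+_ (ℚ.*-zeroʳ w) (𝔼-zero d)) (ℚ.+-identityˡ 0ℚ)
𝔼-∑ d f (y ∷ ys) = trans (cong (_+_ (𝔼 d (f y))) (𝔼-∑ d f ys)) (𝔼-+ d)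
  where
  𝔼-+ : (d : Dist A) {g h : A → ℚ} → 𝔼 d g + 𝔼 d h ≡ 𝔼 d (λ x → g x + h x)
  𝔼-+ []                    = ℚ.+-identityʳ 0ℚ
  𝔼-+ ((w , x) ∷ d) {g} {h} = begin
    (w * g x + 𝔼 d g) + (w * h x + 𝔼 d h)  ≡⟨ +-interchange (w * g x) (𝔼 d g) (w * h x) (𝔼 d h) ⟩
    (w * g x + w * h x) + (𝔼 d g + 𝔼 d h)  ≡⟨ cong₂ _+_ (sym (ℚ.*-distribˡ-+ w (g x) (h x))) (𝔼-+ d) ⟩
    w * (g x + h x) + 𝔼 d (λ x → g x + h x) ∎
    where
    open ≡-Reasoning
    open import Algebra.Properties.CommutativeSemigroup
      (CommutativeMonoid.commutativeSemigroup ℚ.+-0-commutativeMonoid) renaming (interchange to +-interchange)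

uniformWeight : List A → ℚ
uniformWeight []       = 0ℚ
uniformWeight (x ∷ xs) = + 1 / suc (length xs)

ι-length-*-uniformWeight : {xs : List A} {x : A} → x ∈ xs → ι (length xs) * uniformWeight xs ≡ 1ℚ
ι-length-*-uniformWeight {xs = x ∷ xs} _ = trans (ℚ.*-comm (ι (suc (length xs))) (uniformWeight (x ∷ xs))) (1/suc-*-ι (length xs))

𝔼-uniform : (xs : List A) (f : A → ℚ) → 𝔼 (uniform xs) f ≡ uniformWeight xs * ∑ f xs
𝔼-uniform []       f = sym (ℚ.*-zeroˡ 0ℚ)
𝔼-uniform (x ∷ xs) f = 𝔼-weighted (x ∷ xs)
  where
  u = uniformWeight (x ∷ xs)
  𝔼-weighted : ∀ ys → 𝔼 (map (λ y → (u , y)) ys) f ≡ u * ∑ f ys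
  𝔼-weighted []       = sym (ℚ.*-zeroʳ u)
  𝔼-weighted (y ∷ ys) = trans (cong (_+_ (u * f y)) (𝔼-weighted ys)) (sym (ℚ.*-distribˡ-+ u (f y) (∑ f ys)))

𝔼-uniform-const : {xs : List A} {x : A} (f : A → ℚ) {c : ℚ} → x ∈ xs → (∀ {y} → y ∈ xs → f y ≡ c) →
  𝔼 (uniform xs) f ≡ c
𝔼-uniform-const {xs = x ∷ xs} f {c} x∈xs f≡c = begin
  𝔼 (uniform (x ∷ xs)) f  ≡⟨ 𝔼-uniform (x ∷ xs) f ⟩
  u * ∑ f (x ∷ xs)        ≡⟨ cong (u *_) (∑-const f (x ∷ xs) f≡c) ⟩
  u * (n * c)             ≡⟨ ℚ.*-assoc u n c ⟨
  u * n * c               ≡⟨ cong (_* c) (trans (ℚ.*-comm u n) (ι-length-*-uniformWeight x∈xs)) ⟩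
  1ℚ * c                  ≡⟨ ℚ.*-identityˡ c ⟩
  c                       ∎
  where
  open ≡-Reasoning
  u = uniformWeight (x ∷ xs)
  n = ι (length (x ∷ xs))

𝔼-uniform-zero : (xs : List A) (f : A → ℚ) → (∀ {y} → y ∈ xs → f y ≡ 0ℚ) → 𝔼 (uniform xs) f ≡ 0ℚ
𝔼-uniform-zero xs f f≡0 = begin
  𝔼 (uniform xs) f                            ≡⟨ 𝔼-uniform xs f ⟩
  uniformWeight xs * ∑ f xs                   ≡⟨ cong (uniformWeight xs *_) (∑-const f xs f≡0) ⟩
  uniformWeight xs * (ι (length xs) * 0ℚ)     ≡⟨ cong (uniformWeight xs *_) (ℚ.*-zeroʳ (ι (length xs))) ⟩
  uniformWeight xs * 0ℚ                       ≡⟨ ℚ.*-zeroʳ (uniformWeight xs) ⟩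
  0ℚ                                          ∎
  where open ≡-Reasoning

𝔼-uniform-single : {P : A → Set} (P? : Decidable P) (w : ℚ) (f : A → ℚ) → ∀ xs → count P? xs ≡ 1 →
  (∀ {x} → x ∈ xs → P x → w * f x ≡ 1ℚ) → (∀ {x} → x ∈ xs → ¬ P x → f x ≡ 0ℚ) →
  (ι (length xs) * w) * 𝔼 (uniform xs) f ≡ 1ℚ
𝔼-uniform-single P? w f (x ∷ xs) once hit miss = begin
  (n * w) * 𝔼 (uniform (x ∷ xs)) f  ≡⟨ cong ((n * w) *_) (𝔼-uniform (x ∷ xs) f) ⟩
  (n * w) * (u * ∑ f (x ∷ xs))      ≡⟨ *-interchange n w u (∑ f (x ∷ xs)) ⟩
  (n * u) * (w * ∑ f (x ∷ xs))      ≡⟨ cong₂ _*_ (ι-length-*-uniformWeight {xs = x ∷ xs} (here refl)) (*-∑≡count P? w f (x ∷ xs) hit miss) ⟩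
  1ℚ * ι (count P? (x ∷ xs))        ≡⟨ cong (λ m → 1ℚ * ι m) once ⟩
  1ℚ                                ∎
  where
  open ≡-Reasoning
  open import Algebra.Properties.CommutativeSemigroup
    (CommutativeMonoid.commutativeSemigroup ℚ.*-1-commutativeMonoid) renaming (interchange to *-interchange)
  n = ι (length (x ∷ xs))
  u = uniformWeight (x ∷ xs)

uniformWeight-unique : (xs : List A) (f : A → ℚ) {c : ℚ} → (∀ {y} → y ∈ xs → f y ≡ c) → ∑ f xs ≡ 1ℚ →
  c ≡ uniformWeight xs
uniformWeight-unique []       f _   ()
uniformWeight-unique (x ∷ xs) f f≡c ∑≡1 =
  *-inverse-unique (ι (length (x ∷ xs)))
    (trans (sym (∑-const f (x ∷ xs) f≡c)) ∑≡1) (ι-length-*-uniformWeight {xs = x ∷ xs} (here refl))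

-- Admissible π p i k says that π p and k lie on the same side (below, at or above) of the level i.
-- Sides are indexed by Fin 3 so that products over them are Fin-indexed monoid sums.
Side : Set
Side = Fin 3

pattern below = zero
pattern at    = suc zero
pattern above = suc (suc zero)

sideOf : ∀ {n} → Fin n → Fin n → Side
sideOf i k with ℕ.<-cmp (toℕ k) (toℕ i)
... | tri< _ _ _ = below
... | tri≈ _ _ _ = at
... | tri> _ _ _ = above

module _ {n : ℕ} {i k : Fin n} where

  sideOf-< : toℕ k ℕ.< toℕ i → sideOf i k ≡ below
  sideOf-< k<i with ℕ.<-cmp (toℕ k) (toℕ i)
  ... | tri< _ _ _   = refl
  ... | tri≈ k≮i _ _ = ⊥-elim (k≮i k<i)
  ... | tri> k≮i _ _ = ⊥-elim (k≮i k<i)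

  sideOf-≡ : toℕ k ≡ toℕ i → sideOf i k ≡ at
  sideOf-≡ k≡i with ℕ.<-cmp (toℕ k) (toℕ i)
  ... | tri< _ k≢i _ = ⊥-elim (k≢i k≡i)
  ... | tri≈ _ _ _   = refl
  ... | tri> _ k≢i _ = ⊥-elim (k≢i k≡i)

  sideOf-> : toℕ i ℕ.< toℕ k → sideOf i k ≡ above
  sideOf-> i<k with ℕ.<-cmp (toℕ k) (toℕ i)
  ... | tri< _ _ i≮k = ⊥-elim (i≮k i<k)
  ... | tri≈ _ _ i≮k = ⊥-elim (i≮k i<k)
  ... | tri> _ _ _   = refl

  sideOf≡at⇒≡ : sideOf i k ≡ at → k ≡ i
  sideOf≡at⇒≡ side≡at with ℕ.<-cmp (toℕ k) (toℕ i)
  ... | tri≈ _ k≡i _ = toℕ-injective k≡i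

module _ {n : ℕ} (π : Fin n → Fin n) (p : Fin n) {i k : Fin n} where

  admissible⇒sameSide : Admissible π p i k → sideOf i (π p) ≡ sideOf i k
  admissible⇒sameSide (inj₁ (πp≡i , k≡i))        = trans (sideOf-≡ πp≡i) (sym (sideOf-≡ k≡i))
  admissible⇒sameSide (inj₂ (inj₁ (πp<i , k<i))) = trans (sideOf-< πp<i) (sym (sideOf-< k<i))
  admissible⇒sameSide (inj₂ (inj₂ (i<πp , i<k))) = trans (sideOf-> i<πp) (sym (sideOf-> i<k))

  sameSide⇒admissible : sideOf i (π p) ≡ sideOf i k → Admissible π p i k
  sameSide⇒admissible same with ℕ.<-cmp (toℕ (π p)) (toℕ i) | ℕ.<-cmp (toℕ k) (toℕ i)
  ... | tri< πp<i _ _ | tri< k<i _ _ = inj₂ (inj₁ (πp<i , k<i))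
  ... | tri≈ _ πp≡i _ | tri≈ _ k≡i _ = inj₁ (πp≡i , k≡i)
  ... | tri> _ _ i<πp | tri> _ _ i<k = inj₂ (inj₂ (i<πp , i<k))

module _ {n : ℕ} where

  bijective-≗ : {f g : Fin n → Fin n} → (∀ r → f r ≡ g r) → IsBijection f → IsBijection g
  bijective-≗ f≗g (inj , surj) =
    (λ a b ga≡gb → inj a b (trans (f≗g a) (trans ga≡gb (sym (f≗g b))))) ,
    (λ k → proj₁ (surj k) , trans (sym (f≗g _)) (proj₂ (surj k)))

  bijective-∘ : {f : Fin n → Fin n} (σ σ⁻¹ : Fin n → Fin n) →
    (∀ r → σ (σ⁻¹ r) ≡ r) → (∀ r → σ⁻¹ (σ r) ≡ r) → IsBijection f → IsBijection (f ∘ σ)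
  bijective-∘ {f} σ σ⁻¹ σσ⁻¹ σ⁻¹σ (inj , surj) =
    (λ a b fσa≡fσb → trans (sym (σ⁻¹σ a)) (trans (cong σ⁻¹ (inj (σ a) (σ b) fσa≡fσb)) (σ⁻¹σ b))) ,
    (λ k → σ⁻¹ (proj₁ (surj k)) , trans (cong f (σσ⁻¹ _)) (proj₂ (surj k)))

  module _ (p q : Fin n) where

    transpose-matchˡ : transpose p q p ≡ q
    transpose-matchˡ rewrite dec-true (p ≟ p) refl = refl

    transpose-matchʳ : transpose p q q ≡ p
    transpose-matchʳ with q ≟ p
    ... | yes q≡p = q≡p
    ... | no _ rewrite dec-true (q ≟ q) refl = refl

    transpose-other : ∀ {r} → r ≢ p → r ≢ q → transpose p q r ≡ r
    transpose-other {r} r≢p r≢q rewrite dec-false (r ≟ p) r≢p | dec-false (r ≟ q) r≢q = refl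

  just≢nothing : ∀ {k : Fin n} → just k ≢ nothing
  just≢nothing ()

  _⊑_ : State n → State n → Set
  s ⊑ s′ = ∀ p i {k} → s p i ≡ just k → s′ p i ≡ just k

  ⊑-refl : ∀ {s} → s ⊑ s
  ⊑-refl _ _ = id

  ⊑-trans : ∀ {s₁ s₂ s₃} → s₁ ⊑ s₂ → s₂ ⊑ s₃ → s₁ ⊑ s₃
  ⊑-trans s₁⊑s₂ s₂⊑s₃ p i = s₂⊑s₃ p i ∘ s₁⊑s₂ p i

  ⊑-nothing : ∀ {s s′} → s ⊑ s′ → ∀ {q j} → s′ q j ≡ nothing → s q j ≡ nothing
  ⊑-nothing {s} s⊑s′ {q} {j} s′qj≡∅ with s q j in eq
  ... | just _  = ⊥-elim (just≢nothing (trans (sym (s⊑s′ q j eq)) s′qj≡∅))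
  ... | nothing = refl

  free-⊑ : ∀ {s s′ j k} → s ⊑ s′ → Free s′ j k → Free s j k
  free-⊑ s⊑s′ free q = free q ∘ s⊑s′ q _

  Extends : Points n → State n → Set
  Extends y s = ∀ p i {k} → s p i ≡ just k → y p i ≡ k

  WSInJπ : (Fin n → Fin n) → Points n → Set
  WSInJπ π y = IsWSInstance y × InJπ π y

  Extendable : (Fin n → Fin n) → State n → Set
  Extendable π s = ∃ λ y → WSInJπ π y × Extends y s

  Full : State n → Set
  Full s = ∀ p i → s p i ≢ nothing

  extends-full⇒is : ∀ {y s} → Extends y s → Full s → Is y s
  extends-full⇒is {y} {s} y⊒s full p i with s p i in eq
  ... | just k  = cong just (sym (y⊒s p i eq))
  ... | nothing = ⊥-elim (full p i eq)

  module _ {y x : Points n} (y≗x : ∀ p i → y p i ≡ x p i) where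

    IsWSInstance-≗ : IsWSInstance y → IsWSInstance x
    IsWSInstance-≗ y-ws i = bijective-≗ (λ p → y≗x p i) (y-ws i)

    InJπ-≗ : ∀ {π} → InJπ π y → InJπ π x
    InJπ-≗ {π} y-adm p i = subst (Admissible π p i) (y≗x p i) (y-adm p i)

    WSInJπ-≗ : ∀ {π} → WSInJπ π y → WSInJπ π x
    WSInJπ-≗ = Product.map IsWSInstance-≗ InJπ-≗

  is-unique : ∀ {y x : Points n} {s} → Is y s → Is x s → ∀ p i → y p i ≡ x p i
  is-unique is-y is-x p i = just-injective (trans (sym (is-y p i)) (is-x p i))

  extendable-empty : ∀ {π} → IsPermutation π → Extendable π emptyState
  extendable-empty {π} π-bij = (λ p _ → π p) , ((λ _ → π-bij) , (λ p i → sameSide⇒admissible π p {i} refl)) , (λ _ _ ())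

  module _ (s : State n) (p i k : Fin n) where

    update-here : update s p i k p i ≡ just k
    update-here with p ≟ p | i ≟ i
    ... | yes _   | yes _   = refl
    ... | no p≢p  | _       = ⊥-elim (p≢p refl)
    ... | yes _   | no i≢i  = ⊥-elim (i≢i refl)

    ⊑-update : s p i ≡ nothing → s ⊑ update s p i k
    ⊑-update sp≡∅ q j eq with q ≟ p | j ≟ i
    ... | yes refl | yes refl = ⊥-elim (just≢nothing (trans (sym eq) sp≡∅))
    ... | yes _    | no _     = eq
    ... | no _     | _        = eq

    extends-update : ∀ {y} → Extends y s → y p i ≡ k → Extends y (update s p i k)
    extends-update y⊒s ypi≡k q j eq with q ≟ p | j ≟ i
    ... | yes refl | yes refl = trans ypi≡k (just-injective eq)
    ... | yes _    | no _     = y⊒s q j eq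
    ... | no _     | _        = y⊒s q j eq

    free-update : ∀ {j k′} → Free s j k′ → (j ≡ i → k′ ≢ k) → Free (update s p i k) j k′
    free-update {j} free k′≢k q eq with q ≟ p | j ≟ i
    ... | yes refl | yes refl = k′≢k refl (sym (just-injective eq))
    ... | yes _    | no _     = free q eq
    ... | no _     | _        = free q eq

    update-≢ : ∀ {q j} → q ≢ p ⊎ j ≢ i → update s p i k q j ≡ s q j
    update-≢ {q} {j} ne with q ≟ p | j ≟ i
    update-≢ (inj₁ p≢p) | yes refl | yes refl = ⊥-elim (p≢p refl)
    update-≢ (inj₂ i≢i) | yes refl | yes refl = ⊥-elim (i≢i refl)
    ... | yes _ | no _ = refl
    ... | no _  | _    = refl

    ¬free-update : ¬ Free (update s p i k) i k
    ¬free-update free = free p (update-here)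

  swapAt : Fin n → Fin n → Fin n → Points n → Points n
  swapAt i p q y r j with j ≟ i
  ... | yes _ = y (transpose p q r) j
  ... | no _  = y r j

  module _ (i p q : Fin n) (y : Points n) where

    swapAt-≡ : ∀ r → swapAt i p q y r i ≡ y (transpose p q r) i
    swapAt-≡ r with i ≟ i
    ... | yes _  = refl
    ... | no i≢i = ⊥-elim (i≢i refl)

    swapAt-≢ : ∀ r {j} → j ≢ i → swapAt i p q y r j ≡ y r j
    swapAt-≢ r {j} j≢i with j ≟ i
    ... | yes j≡i = ⊥-elim (j≢i j≡i)
    ... | no _    = refl

    swapAt-ws : IsWSInstance y → IsWSInstance (swapAt i p q y)
    swapAt-ws y-ws j with j ≟ i
    ... | yes refl = bijective-∘ (transpose p q) (transpose q p) (λ _ → transpose-inverse p q) (λ _ → transpose-inverse q p) (y-ws i)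
    ... | no _     = y-ws j

  -- The completion is repaired by swapping p with the player q holding k at level i: k is admissible
  -- for both, so p and q lie on the same side of i and may trade their points there.
  extendable-update : ∀ {π s p i k} → Extendable π s → s p i ≡ nothing → Free s i k → Admissible π p i k →
    Extendable π (update s p i k)
  extendable-update {π} {s} {p} {i} {k} (y , (y-ws , y-adm) , y⊒s) sp≡∅ k-free k-adm =
    y′ , (swapAt-ws i p q y y-ws , y′-adm) , y′⊒s′
    where
    q : Fin n
    q = proj₁ (proj₂ (y-ws i) k)
    yqi≡k : y q i ≡ k
    yqi≡k = proj₂ (proj₂ (y-ws i) k)

    y′ : Points n
    y′ = swapAt i p q y

    swapped-adm : ∀ r → Admissible π r i (y (transpose p q r) i)
    swapped-adm r = cases (r ≟ p) (r ≟ q)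
      where
      q-adm : Admissible π q i (y p i)
      q-adm = sameSide⇒admissible π q (begin
        sideOf i (π q)     ≡⟨ admissible⇒sameSide π q (y-adm q i) ⟩
        sideOf i (y q i)   ≡⟨ cong (sideOf i) yqi≡k ⟩
        sideOf i k         ≡⟨ admissible⇒sameSide π p k-adm ⟨
        sideOf i (π p)     ≡⟨ admissible⇒sameSide π p (y-adm p i) ⟩
        sideOf i (y p i)   ∎)
        where open ≡-Reasoning
      cases : Dec (r ≡ p) → Dec (r ≡ q) → Admissible π r i (y (transpose p q r) i)
      cases (yes refl) _          = subst (Admissible π p i) (sym (trans (cong (λ t → y t i) (transpose-matchˡ p q)) yqi≡k)) k-adm
      cases (no _)     (yes refl) = subst (Admissible π q i) (sym (cong (λ t → y t i) (transpose-matchʳ p q))) q-adm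
      cases (no r≢p)   (no r≢q)   = subst (Admissible π r i) (sym (cong (λ t → y t i) (transpose-other p q r≢p r≢q))) (y-adm r i)

    y′-adm : InJπ π y′
    y′-adm r j with j ≟ i
    ... | yes refl = swapped-adm r
    ... | no _     = y-adm r j

    y′⊒s′ : Extends y′ (update s p i k)
    y′⊒s′ r j {k′} = cases (r ≟ p) (j ≟ i)
      where
      swapped-extends : r ≢ p → s r i ≡ just k′ → y (transpose p q r) i ≡ k′
      swapped-extends r≢p eq with r ≟ q
      ... | yes refl = ⊥-elim (k-free q (trans eq (cong just (trans (sym (y⊒s q i eq)) yqi≡k))))
      ... | no r≢q   = trans (cong (λ t → y t i) (transpose-other p q r≢p r≢q)) (y⊒s r i eq)
      cases : Dec (r ≡ p) → Dec (j ≡ i) → update s p i k r j ≡ just k′ → y′ r j ≡ k′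
      cases (yes refl) (yes refl) eq = begin
        y′ p i                 ≡⟨ swapAt-≡ i p q y p ⟩
        y (transpose p q p) i  ≡⟨ cong (λ t → y t i) (transpose-matchˡ p q) ⟩
        y q i                  ≡⟨ yqi≡k ⟩
        k                      ≡⟨ just-injective (trans (sym (update-here s p i k)) eq) ⟩
        k′                     ∎
        where open ≡-Reasoning
      cases (no r≢p)   (yes refl) eq =
        trans (swapAt-≡ i p q y r) (swapped-extends r≢p (trans (sym (update-≢ s p i k (inj₁ r≢p))) eq))
      cases _          (no j≢i)   eq =
        trans (swapAt-≢ i p q y r j≢i) (y⊒s r j (trans (sym (update-≢ s p i k (inj₂ j≢i))) eq))

module _ {n : ℕ} where

  freeCount : State n → Fin n → Side → ℕ
  freeCount s j c = count (λ k → free? s j k ×-dec (sideOf j k ≟ c)) (allFin n)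

  -- weight s is the number of completions of s in 𝒥_π: at each level, the free points of each side
  -- can be handed out in any order to the players of that side whose point is still unfixed.
  weight : State n → ℕ
  weight s = ℕ*.sum λ j → ℕ*.sum λ c → freeCount s j c !

  length-candidates : ∀ π s (p i : Fin n) → length (candidates π s p i) ≡ freeCount s i (sideOf i (π p))
  length-candidates π s p i =
    count-≐ (λ k → free? s i k ×-dec admissible? π p i k) (λ k → free? s i k ×-dec (sideOf i k ≟ sideOf i (π p)))
      ((λ (free , adm) → free , sym (admissible⇒sameSide π p adm)) ,
       (λ (free , same) → free , sameSide⇒admissible π p (sym same)))
      (allFin n)

  module _ {s : State n} {p i k : Fin n} (sp≡∅ : s p i ≡ nothing) (k-free : Free s i k) where

    private
      s′ = update s p i k

    freeCount-update-≢ : ∀ {j c} → ¬ (j ≡ i × c ≡ sideOf i k) → freeCount s j c ≡ freeCount s′ j c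
    freeCount-update-≢ {j} {c} ne = count-≐ _ _
      ((λ (free , side≡c) → free-update s p i k free (λ { refl refl → ne (refl , sym side≡c) }) , side≡c) ,
       (λ (free , side≡c) → free-⊑ (⊑-update s p i k sp≡∅) free , side≡c))
      (allFin n)

    freeCount-update-≡ : freeCount s i (sideOf i k) ≡ suc (freeCount s′ i (sideOf i k))
    freeCount-update-≡ = count-allFin-dropAt _ _ k (k-free , refl) (λ (free , _) → ¬free-update s p i k free)
      (λ k′ k′≢k (free , side) → free-update s p i k free (λ _ → k′≢k) , side)
      (λ _ _ (free , side) → free-⊑ (⊑-update s p i k sp≡∅) free , side)

    weight-update : weight s ≡ freeCount s i (sideOf i k) ℕ.* weight s′
    weight-update = begin
      weight s                                ≡⟨ sum-scaleAt ℕ.*-1-commutativeMonoid _ _ i (suc m) level-i other-levels ⟩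
      suc m ℕ.* weight s′                     ≡⟨ cong (ℕ._* weight s′) freeCount-update-≡ ⟨
      freeCount s i (sideOf i k) ℕ.* weight s′ ∎
      where
      open ≡-Reasoning
      m = freeCount s′ i (sideOf i k)
      level-i : ℕ*.sum (λ c → freeCount s i c !) ≡ suc m ℕ.* ℕ*.sum (λ c → freeCount s′ i c !)
      level-i = sum-scaleAt ℕ.*-1-commutativeMonoid _ _ (sideOf i k) (suc m) (cong _! freeCount-update-≡)
        (λ c c≢side → cong _! (freeCount-update-≢ {i} {c} (c≢side ∘ proj₂)))
      other-levels : ∀ j → j ≢ i → ℕ*.sum (λ c → freeCount s j c !) ≡ ℕ*.sum (λ c → freeCount s′ j c !)
      other-levels j j≢i = ℕ*.sum-cong-≗ (λ c → cong _! (freeCount-update-≢ {j} {c} (j≢i ∘ proj₁)))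

    weight-fix : ∀ π → Admissible π p i k → weight s ≡ length (candidates π s p i) ℕ.* weight s′
    weight-fix π k-adm = trans weight-update (cong (ℕ._* weight s′) (begin
      freeCount s i (sideOf i k)     ≡⟨ cong (freeCount s i) (admissible⇒sameSide π p k-adm) ⟨
      freeCount s i (sideOf i (π p)) ≡⟨ length-candidates π s p i ⟨
      length (candidates π s p i)    ∎))
      where open ≡-Reasoning

  weight-full : ∀ {y s} → IsWSInstance y → Extends y s → Full s → weight s ≡ 1
  weight-full {y} {s} y-ws y⊒s full =
    trans (ℕ*.sum-cong-≗ λ j → ℕ*.sum-cong-≗ {3} λ c → cong _! (none-free j c)) (ℕ*.sum-replicate-zero n)
    where
    ¬free : ∀ j k → ¬ Free s j k
    ¬free j k free with proj₂ (y-ws j) k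
    ... | q , yqj≡k with s q j in eq
    ...   | just k′ = free q (trans eq (cong just (trans (sym (y⊒s q j eq)) yqj≡k)))
    ...   | nothing = full q j eq
    none-free : ∀ j c → freeCount s j c ≡ 0
    none-free j c = count-none (λ k → free? s j k ×-dec (sideOf j k ≟ c)) (λ k (free , _) → ¬free j k free) (allFin n)

module _ {B : Set} {R : B → B → Set} (R? : ∀ a b → Dec (R a b)) where

  pointwise? : ∀ {m} (f : Fin m → B) → Decidable (λ (g : Fin m → B) → ∀ j → R (g j) (f j))
  pointwise? f g = all? (λ j → R? (g j) (f j))

module _ {B : Set} {R : B → B → Set} (R? : ∀ a b → Dec (R a b)) (bs : List B) where

  private
    -- cons stands for the pattern-matching lambda in the definition of allFuns, which cannot be named.
    count-prepend : ∀ {m} (f : Fin (suc m) → B) (cons : B → (Fin m → B) → Fin (suc m) → B) →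
      (∀ b g → cons b g zero ≡ b) → (∀ b g j → cons b g (suc j) ≡ g j) →
      (L : List (Fin m → B)) → count (pointwise? R? (f ∘ suc)) L ≡ 1 → count (λ a → R? a (f zero)) bs ≡ 1 →
      count (pointwise? R? f) (concatMap (λ b → map (cons b) L) bs) ≡ 1
    count-prepend f cons cons-zero cons-suc L once-L once-bs = begin
      count (pointwise? R? f) (concatMap (λ b → map (cons b) L) bs)     ≡⟨ count-concatMap (pointwise? R? f) _ bs ⟩
      ℕ.sum (map (λ b → count (pointwise? R? f) (map (cons b) L)) bs)  ≡⟨ cong ℕ.sum (map-cong each bs) ⟩
      ℕ.sum (map (λ b → count (λ a → R? a (f zero)) [ b ]) bs)      ≡⟨ count-as-sum (λ a → R? a (f zero)) bs ⟨
      count (λ a → R? a (f zero)) bs                               ≡⟨ once-bs ⟩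
      1                                                            ∎
      where
      open ≡-Reasoning
      each : ∀ b → count (pointwise? R? f) (map (cons b) L) ≡ count (λ a → R? a (f zero)) [ b ]
      each b with R? b (f zero)
      ... | yes Rb = begin
        count (pointwise? R? f) (map (cons b) L)     ≡⟨ count-map (pointwise? R? f) (cons b) L ⟩
        count (pointwise? R? f ∘ cons b) L           ≡⟨ count-≐ _ (pointwise? R? (f ∘ suc)) (to , from) L ⟩
        count (pointwise? R? (f ∘ suc)) L            ≡⟨ once-L ⟩
        1                                         ∎
        where
        to : ∀ {g} → (∀ j → R (cons b g j) (f j)) → ∀ j → R (g j) (f (suc j))
        to {g} R-cons j = subst (λ t → R t (f (suc j))) (cons-suc b g j) (R-cons (suc j))
        from : ∀ {g} → (∀ j → R (g j) (f (suc j))) → ∀ j → R (cons b g j) (f j)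
        from {g} R-g zero    = subst (λ t → R t (f zero)) (sym (cons-zero b g)) Rb
        from {g} R-g (suc j) = subst (λ t → R t (f (suc j))) (sym (cons-suc b g j)) (R-g j)
      ... | no ¬Rb = trans (count-map (pointwise? R? f) (cons b) L)
        (count-none _ (λ g R-cons → ¬Rb (subst (λ t → R t (f zero)) (cons-zero b g) (R-cons zero))) L)

  count-allFuns : (∀ b → count (λ a → R? a b) bs ≡ 1) → ∀ m (f : Fin m → B) → count (pointwise? R? f) (allFuns bs m) ≡ 1
  count-allFuns once zero    f = refl
  count-allFuns once (suc m) f =
    count-prepend f _ (λ _ _ → refl) (λ _ _ _ → refl) (allFuns bs m) (count-allFuns once m (f ∘ suc)) (once (f zero))

module _ {n : ℕ} where

  ∈-allPerms⁻ : ∀ {π} → π ∈ allPerms n → IsPermutation π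
  ∈-allPerms⁻ = proj₂ ∘ ∈-filter⁻ isBijection? {xs = allFuns (allFin n) n}

  ∈-allJ⁻ : ∀ {y} → y ∈ allJ n → InJ y
  ∈-allJ⁻ = proj₂ ∘ ∈-filter⁻ inJ? {xs = allFuns (allFuns (allFin n) n) n}

  InJ-≗ : ∀ {y x : Points n} → (∀ p i → y p i ≡ x p i) → InJ y → InJ x
  InJ-≗ y≗x = Product.map (IsWSInstance-≗ y≗x) (Any.map (InJπ-≗ y≗x))

  count-allPerms : ∀ {π₀} → IsPermutation π₀ → count (pointwise? _≟_ π₀) (allPerms n) ≡ 1
  count-allPerms {π₀} π₀-bij = trans
    (count-filter isBijection? (pointwise? _≟_ π₀) (λ π≗π₀ → bijective-≗ (sym ∘ π≗π₀) π₀-bij) (allFuns (allFin n) n))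
    (count-allFuns _≟_ (allFin n) count-≟-allFin n π₀)

  count-allJ : ∀ {y₀} → InJ y₀ → count (_≟ᴾ y₀) (allJ n) ≡ 1
  count-allJ {y₀} y₀∈J = trans
    (count-filter inJ? (_≟ᴾ y₀) (λ y≗y₀ → InJ-≗ (λ p i → sym (y≗y₀ p i)) y₀∈J) (allFuns (allFuns (allFin n) n) n))
    (count-allFuns (λ a b → all? λ i → a i ≟ b i) (allFuns (allFin n) n) (count-allFuns _≟_ (allFin n) count-≟-allFin n) n y₀)

module _ {n : ℕ} (π : Fin n → Fin n) where

  ∈-candidates⁻ : ∀ s p i {k} → k ∈ candidates π s p i → Free s i k × Admissible π p i k
  ∈-candidates⁻ s p i = proj₂ ∘ ∈-filter⁻ (λ k → free? s i k ×-dec admissible? π p i k) {xs = allFin n}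

  ∈-candidates⁺ : ∀ s p i {k} → Free s i k → Admissible π p i k → k ∈ candidates π s p i
  ∈-candidates⁺ s p i {k} free adm = ∈-filter⁺ (λ k → free? s i k ×-dec admissible? π p i k) (∈-allFin k) (free , adm)

  unfixed-free : ∀ {y : Points n} {s p i} → IsWSInstance y → Extends y s → s p i ≡ nothing → Free s i (y p i)
  unfixed-free {y} {s} {p} {i} y-ws y⊒s sp≡∅ q eq with proj₁ (y-ws i) q p (y⊒s q i eq)
  ... | refl = just≢nothing (trans (sym eq) sp≡∅)

  module _ {s : State n} {p i : Fin n} (F : State n × Fin n → ℚ) where

    𝔼-fix-fixed : ∀ {k} → s p i ≡ just k → 𝔼 (fix π s p i) F ≡ F (s , k)
    𝔼-fix-fixed {k} eq with s p i | eq
    ... | just _ | refl = 𝔼-return (s , k) F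

    𝔼-fix-unfixed : s p i ≡ nothing → 𝔼 (fix π s p i) F ≡ 𝔼 (uniform (candidates π s p i)) (λ k → F (update s p i k , k))
    𝔼-fix-unfixed eq with s p i | eq
    ... | nothing | refl = trans (𝔼->>= (uniform (candidates π s p i)) (λ k → return (update s p i k , k)) F)
                                 (𝔼-cong (uniform (candidates π s p i)) (λ k → 𝔼-return (update s p i k , k) F))

    𝔼-fix-const : ∀ {c} → Extendable π s →
      (∀ {s′ k} → Extendable π s′ → s ⊑ s′ → s′ p i ≡ just k → F (s′ , k) ≡ c) → 𝔼 (fix π s p i) F ≡ c
    𝔼-fix-const {c} ext@(y , (y-ws , y-adm) , y⊒s) outcome = cases (s p i) refl
      where
      cases : ∀ m → s p i ≡ m → 𝔼 (fix π s p i) F ≡ c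
      cases (just k) eq = trans (𝔼-fix-fixed eq) (outcome ext ⊑-refl eq)
      cases nothing  eq = trans (𝔼-fix-unfixed eq) (𝔼-uniform-const (λ k → F (update s p i k , k))
        (∈-candidates⁺ s p i (unfixed-free y-ws y⊒s eq) (y-adm p i))
        (λ {k} k∈C → let (free , adm) = ∈-candidates⁻ s p i k∈C in
          outcome (extendable-update ext eq free adm) (⊑-update s p i k eq) (update-here s p i k)))

    weight-𝔼-fix : ∀ {x} → WSInJπ π x → Extends x s →
      (∀ {s′} → s ⊑ s′ → Extends x s′ → s′ p i ≡ just (x p i) → ι (weight s′) * F (s′ , x p i) ≡ 1ℚ) →
      (∀ {s′ k} → Extendable π s′ → s ⊑ s′ → s′ p i ≡ just k → k ≢ x p i → F (s′ , k) ≡ 0ℚ) →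
      ι (weight s) * 𝔼 (fix π s p i) F ≡ 1ℚ
    weight-𝔼-fix {x} x∈Jπ@(x-ws , x-adm) x⊒s hit miss = cases (s p i) refl
      where
      cases : ∀ m → s p i ≡ m → ι (weight s) * 𝔼 (fix π s p i) F ≡ 1ℚ
      cases (just k) eq = trans (cong (ι (weight s) *_) (𝔼-fix-fixed eq))
        (subst (λ t → ι (weight s) * F (s , t) ≡ 1ℚ) (x⊒s p i eq) (hit ⊑-refl x⊒s (trans eq (cong just (sym (x⊒s p i eq))))))
      cases nothing  eq = begin
        ι (weight s) * 𝔼 (fix π s p i) F
          ≡⟨ cong₂ _*_ (cong ι (weight-fix eq x-free π (x-adm p i))) (𝔼-fix-unfixed eq) ⟩
        ι (length C ℕ.* weight s₀) * 𝔼 (uniform C) F′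
          ≡⟨ cong (_* 𝔼 (uniform C) F′) (ι-* (length C) (weight s₀)) ⟩
        (ι (length C) * ι (weight s₀)) * 𝔼 (uniform C) F′
          ≡⟨ 𝔼-uniform-single (_≟ k₀) (ι (weight s₀)) F′ C count≡1 hit′ miss′ ⟩
        1ℚ ∎
        where
        open ≡-Reasoning
        k₀ = x p i
        C  = candidates π s p i
        s₀ = update s p i k₀
        F′ : Fin n → ℚ
        F′ k = F (update s p i k , k)
        x-free : Free s i k₀
        x-free = unfixed-free x-ws x⊒s eq
        count≡1 : count (_≟ k₀) C ≡ 1
        count≡1 = trans (count-filter _ (_≟ k₀) (λ { refl → x-free , x-adm p i }) (allFin n)) (count-≟-allFin k₀)
        hit′ : ∀ {k} → k ∈ C → k ≡ k₀ → ι (weight s₀) * F′ k ≡ 1ℚ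
        hit′ _ refl = hit (⊑-update s p i k₀ eq) (extends-update s p i k₀ x⊒s refl) (update-here s p i k₀)
        miss′ : ∀ {k} → k ∈ C → k ≢ k₀ → F′ k ≡ 0ℚ
        miss′ {k} k∈C k≢k₀ = let (free , adm) = ∈-candidates⁻ s p i k∈C in
          miss (extendable-update (x , x∈Jπ , x⊒s) eq free adm) (⊑-update s p i k eq) (update-here s p i k) k≢k₀

  Covers : List (Fin n × Fin n) → State n → Set
  Covers ps s = ∀ q j → s q j ≡ nothing → (q , j) ∈ ps

  covers-allPairs : ∀ s → Covers (allPairs n) s
  covers-allPairs s q j _ = ∈-concat⁺′ (∈-map⁺ (λ p → (p , j)) (∈-allFin q)) (∈-map⁺ _ (∈-allFin j))

  covers-[] : ∀ {s} → Covers [] s → Full s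
  covers-[] cov q j eq with cov q j eq
  ... | ()

  covers-∷ : ∀ {p i ps s s′ k} → Covers ((p , i) ∷ ps) s → s ⊑ s′ → s′ p i ≡ just k → Covers ps s′
  covers-∷ cov s⊑s′ s′pi q j s′qj≡∅ with cov q j (⊑-nothing s⊑s′ s′qj≡∅)
  ... | here refl  = ⊥-elim (just≢nothing (trans (sym s′pi) s′qj≡∅))
  ... | there q,j∈ = q,j∈

  ConstantOnCompletions : State n → (State n → ℚ) → ℚ → Set
  ConstantOnCompletions s g c = ∀ {s′ y} → s ⊑ s′ → WSInJπ π y → Is y s′ → g s′ ≡ c

  private
    constant-⊑ : ∀ {s s′ g c} → s ⊑ s′ → ConstantOnCompletions s g c → ConstantOnCompletions s′ g c
    constant-⊑ s⊑s′ const s′⊑s″ = const (⊑-trans s⊑s′ s′⊑s″)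

  𝔼-fillAll-const : ∀ ps {s} (g : State n → ℚ) {c} → Extendable π s → Covers ps s → ConstantOnCompletions s g c →
    𝔼 (fillAll π ps s) g ≡ c
  𝔼-fillAll-const [] {s} g (y , y∈Jπ , y⊒s) cov const =
    trans (𝔼-return s g) (const ⊑-refl y∈Jπ (extends-full⇒is y⊒s (covers-[] cov)))
  𝔼-fillAll-const ((p , i) ∷ ps) {s} g ext cov const =
    trans (𝔼->>= (fix π s p i) _ g) (𝔼-fix-const _ ext λ ext′ s⊑s′ s′pi →
      𝔼-fillAll-const ps g ext′ (covers-∷ cov s⊑s′ s′pi) (constant-⊑ s⊑s′ const))

  𝔼-run-const : ∀ {R} (P : Protocol n R) {s} (g : State n → ℚ) {c} → Extendable π s → ConstantOnCompletions s g c →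
    𝔼 (run π s P) g ≡ c
  𝔼-run-const (done _)    {s} g ext const = 𝔼-fillAll-const (allPairs n) g ext (covers-allPairs s) const
  𝔼-run-const (cut p i κ) {s} g ext const =
    trans (𝔼->>= (fix π s p i) _ g) (𝔼-fix-const _ ext λ {_} {k} ext′ s⊑s′ _ →
      𝔼-run-const (κ k) g ext′ (constant-⊑ s⊑s′ const))

  conflict⇒𝟙-is≡0 : ∀ {x s p i k} → s p i ≡ just k → k ≢ x p i → ConstantOnCompletions s (𝟙 ∘ is? x) 0ℚ
  conflict⇒𝟙-is≡0 {x} {p = p} {i} spi k≢xpi {s′} s⊑s′ _ _ =
    𝟙-no (is? x s′) (λ is-x → k≢xpi (just-injective (trans (sym (s⊑s′ p i spi)) (is-x p i))))

  weight-𝔼-fillAll : ∀ {x} ps {s} → WSInJπ π x → Covers ps s → Extends x s →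
    ι (weight s) * 𝔼 (fillAll π ps s) (𝟙 ∘ is? x) ≡ 1ℚ
  weight-𝔼-fillAll {x} [] {s} (x-ws , _) cov x⊒s =
    cong₂ _*_ (cong ι (weight-full x-ws x⊒s full))
              (trans (𝔼-return s (𝟙 ∘ is? x)) (𝟙-yes (is? x s) (extends-full⇒is x⊒s full)))
    where
    full : Full s
    full = covers-[] cov
  weight-𝔼-fillAll {x} ((p , i) ∷ ps) {s} x∈Jπ cov x⊒s =
    trans (cong (ι (weight s) *_) (𝔼->>= (fix π s p i) _ _)) (weight-𝔼-fix _ x∈Jπ x⊒s
      (λ s⊑s′ x⊒s′ s′pi → weight-𝔼-fillAll ps x∈Jπ (covers-∷ cov s⊑s′ s′pi) x⊒s′)
      (λ ext′ s⊑s′ s′pi k≢xpi →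
        𝔼-fillAll-const ps _ ext′ (covers-∷ cov s⊑s′ s′pi) (conflict⇒𝟙-is≡0 s′pi k≢xpi)))

  weight-𝔼-run : ∀ {R} (P : Protocol n R) {x s} → WSInJπ π x → Extends x s →
    ι (weight s) * 𝔼 (run π s P) (𝟙 ∘ is? x) ≡ 1ℚ
  weight-𝔼-run (done _)    {s = s} x∈Jπ x⊒s = weight-𝔼-fillAll (allPairs n) x∈Jπ (covers-allPairs s) x⊒s
  weight-𝔼-run (cut p i κ) {x} {s} x∈Jπ x⊒s =
    trans (cong (ι (weight s) *_) (𝔼->>= (fix π s p i) _ _)) (weight-𝔼-fix _ x∈Jπ x⊒s
      (λ _ x⊒s′ _ → weight-𝔼-run (κ (x p i)) x∈Jπ x⊒s′)
      (λ {_} {k} ext′ _ s′pi k≢xpi → 𝔼-run-const (κ k) _ ext′ (conflict⇒𝟙-is≡0 s′pi k≢xpi)))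

InJπ-unique : ∀ {n} {π π′ : Fin n → Fin n} {x : Points n} → InJπ π x → InJπ π′ x → ∀ p → π′ p ≡ π p
InJπ-unique {π = π} {π′} {x} x∈Jπ x∈Jπ′ p = sideOf≡at⇒≡ (begin
  sideOf (π p) (π′ p)         ≡⟨ admissible⇒sameSide π′ p (x∈Jπ′ p (π p)) ⟩
  sideOf (π p) (x p (π p))    ≡⟨ admissible⇒sameSide π p (x∈Jπ p (π p)) ⟨
  sideOf (π p) (π p)          ≡⟨ sideOf-≡ refl ⟩
  at                          ∎)
  where open ≡-Reasoning

InJπ-π-≗ : ∀ {n} {π π′ : Fin n → Fin n} {x : Points n} → (∀ p → π p ≡ π′ p) → InJπ π x → InJπ π′ x
InJπ-π-≗ {π = π} {π′} π≗π′ x∈Jπ p i =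
  sameSide⇒admissible π′ p (trans (cong (sideOf i) (sym (π≗π′ p))) (admissible⇒sameSide π p (x∈Jπ p i)))

module _ {n : ℕ} {R : Set} (P : Protocol n R) where

  Pr-adversary : ∀ x → Pr (adversary P) (is? x) ≡ 𝔼 (uniform (allPerms n)) (λ π → Pr (run π emptyState P) (is? x))
  Pr-adversary x = trans (Pr≡𝔼 (adversary P) (is? x)) (trans (𝔼->>= (uniform (allPerms n)) _ _)
    (𝔼-cong (uniform (allPerms n)) λ π → sym (Pr≡𝔼 (run π emptyState P) (is? x))))

  weight-Pr-run : ∀ {π x} → WSInJπ π x → ι (weight {n} emptyState) * Pr (run π emptyState P) (is? x) ≡ 1ℚ
  weight-Pr-run {π} {x} x∈Jπ =
    trans (cong (ι (weight {n} emptyState) *_) (Pr≡𝔼 (run π emptyState P) (is? x)))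
          (weight-𝔼-run π P {x} {emptyState} x∈Jπ (λ _ _ ()))

  Pr-run-∉Jπ : ∀ {π x} → IsPermutation π → ¬ WSInJπ π x → Pr (run π emptyState P) (is? x) ≡ 0ℚ
  Pr-run-∉Jπ {π} {x} π-bij x∉Jπ = trans (Pr≡𝔼 (run π emptyState P) (is? x))
    (𝔼-run-const π P (𝟙 ∘ is? x) (extendable-empty π-bij) λ {s′} _ y∈Jπ is-y →
      𝟙-no (is? x s′) (λ is-x → x∉Jπ (WSInJπ-≗ (is-unique is-y is-x) y∈Jπ)))

  ∑-Pr-run : ∀ {π} → π ∈ allPerms n → ∑ (λ y → Pr (run π emptyState P) (is? y)) (allJ n) ≡ 1ℚ
  ∑-Pr-run {π} π∈ = begin
    ∑ (λ y → Pr (run π emptyState P) (is? y)) (allJ n)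
      ≡⟨ ∑-cong (λ y → Pr≡𝔼 (run π emptyState P) (is? y)) (allJ n) ⟩
    ∑ (λ y → 𝔼 (run π emptyState P) (𝟙 ∘ is? y)) (allJ n)
      ≡⟨ 𝔼-∑ (run π emptyState P) (λ y → 𝟙 ∘ is? y) (allJ n) ⟩
    𝔼 (run π emptyState P) (λ s → ∑ (λ y → 𝟙 (is? y s)) (allJ n))
      ≡⟨ 𝔼-run-const π P _ (extendable-empty (∈-allPerms⁻ π∈)) one ⟩
    1ℚ ∎
    where
    open ≡-Reasoning
    one : ConstantOnCompletions π emptyState (λ s → ∑ (λ y → 𝟙 (is? y s)) (allJ n)) 1ℚ
    one {s′} {y₀} _ (y₀-ws , y₀-adm) is-y₀ = begin
      ∑ (λ y → 𝟙 (is? y s′)) (allJ n)      ≡⟨ ∑-𝟙 (λ y → is? y s′) (allJ n) ⟩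
      ι (count (λ y → is? y s′) (allJ n))  ≡⟨ cong ι (count-≐ (λ y → is? y s′) (_≟ᴾ y₀) (is⇒≗y₀ , ≗y₀⇒is) (allJ n)) ⟩
      ι (count (_≟ᴾ y₀) (allJ n))          ≡⟨ cong ι (count-allJ (y₀-ws , lose π∈ y₀-adm)) ⟩
      1ℚ                                   ∎
      where
      is⇒≗y₀ : ∀ {y} → Is y s′ → ∀ p i → y p i ≡ y₀ p i
      is⇒≗y₀ is-y = is-unique is-y is-y₀
      ≗y₀⇒is : ∀ {y} → (∀ p i → y p i ≡ y₀ p i) → Is y s′
      ≗y₀⇒is y≗y₀ p i = trans (is-y₀ p i) (cong just (sym (y≗y₀ p i)))

  weight-∑-Pr-run : ∀ {x} → InJ x → ι (weight {n} emptyState) * ∑ (λ π → Pr (run π emptyState P) (is? x)) (allPerms n) ≡ 1ℚ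
  weight-∑-Pr-run {x} (x-ws , x∈J) =
    let π₀ , π₀∈ , x∈Jπ₀ = find x∈J in
    trans (*-∑≡count (pointwise? _≟_ π₀) (ι (weight {n} emptyState)) (λ π → Pr (run π emptyState P) (is? x)) (allPerms n)
            (λ _ π≗π₀ → weight-Pr-run (x-ws , InJπ-π-≗ (sym ∘ π≗π₀) x∈Jπ₀))
            (λ π∈ π≉π₀ → Pr-run-∉Jπ (∈-allPerms⁻ π∈) (λ (_ , x∈Jπ) → π≉π₀ (InJπ-unique x∈Jπ₀ x∈Jπ))))
          (cong ι (count-allPerms (∈-allPerms⁻ π₀∈)))

  Pr-adversary-∉J : ∀ {x} → ¬ InJ x → Pr (adversary P) (is? x) ≡ 0ℚ
  Pr-adversary-∉J {x} x∉J = trans (Pr-adversary x) (𝔼-uniform-zero (allPerms n) _ λ π∈ →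
    Pr-run-∉Jπ (∈-allPerms⁻ π∈) (λ (x-ws , x∈Jπ) → x∉J (x-ws , lose π∈ x∈Jπ)))

  -- weight emptyState does not depend on π, so all y ∈ 𝒥 get the same probability; these sum to 1.
  Pr-adversary-∈J : ∀ {x} → InJ x → Pr (adversary P) (is? x) ≡ uniformWeight (allJ n)
  Pr-adversary-∈J {x} x∈J = uniformWeight-unique (allJ n) (λ y → Pr (adversary P) (is? y)) constant total
    where
    S : Points n → ℚ
    S y = ∑ (λ π → Pr (run π emptyState P) (is? y)) (allPerms n)
    Pr≡S : ∀ y → Pr (adversary P) (is? y) ≡ uniformWeight (allPerms n) * S y
    Pr≡S y = trans (Pr-adversary y) (𝔼-uniform (allPerms n) _)
    constant : ∀ {y} → y ∈ allJ n → Pr (adversary P) (is? y) ≡ Pr (adversary P) (is? x)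
    constant {y} y∈ = begin
      Pr (adversary P) (is? y)         ≡⟨ Pr≡S y ⟩
      uniformWeight (allPerms n) * S y ≡⟨ cong (uniformWeight (allPerms n) *_) S-const ⟩
      uniformWeight (allPerms n) * S x ≡⟨ Pr≡S x ⟨
      Pr (adversary P) (is? x)         ∎
      where
      open ≡-Reasoning
      S-const : S y ≡ S x
      S-const = *-inverse-unique (ι (weight {n} emptyState)) (weight-∑-Pr-run (∈-allJ⁻ y∈)) (weight-∑-Pr-run x∈J)
    total : ∑ (λ y → Pr (adversary P) (is? y)) (allJ n) ≡ 1ℚ
    total = let _ , π₀∈ , _ = find (proj₂ x∈J) in begin
      ∑ (λ y → Pr (adversary P) (is? y)) (allJ n)
        ≡⟨ ∑-cong Pr-adversary (allJ n) ⟩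
      ∑ (λ y → 𝔼 (uniform (allPerms n)) (λ π → Pr (run π emptyState P) (is? y))) (allJ n)
        ≡⟨ 𝔼-∑ (uniform (allPerms n)) _ (allJ n) ⟩
      𝔼 (uniform (allPerms n)) (λ π → ∑ (λ y → Pr (run π emptyState P) (is? y)) (allJ n))
        ≡⟨ 𝔼-uniform-const _ π₀∈ ∑-Pr-run ⟩
      1ℚ ∎
      where open ≡-Reasoning

Pr-𝒟-∉J : ∀ {n} {x : Points n} → ¬ InJ x → Pr (𝒟 n) (_≟ᴾ x) ≡ 0ℚ
Pr-𝒟-∉J {n} {x} x∉J = trans (Pr≡𝔼 (𝒟 n) (_≟ᴾ x)) (𝔼-uniform-zero (allJ n) _ λ {y} y∈ →
  𝟙-no (y ≟ᴾ x) (λ y≗x → x∉J (InJ-≗ y≗x (∈-allJ⁻ y∈))))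

Pr-𝒟-∈J : ∀ {n} {x : Points n} → InJ x → Pr (𝒟 n) (_≟ᴾ x) ≡ uniformWeight (allJ n)
Pr-𝒟-∈J {n} {x} x∈J = begin
  Pr (𝒟 n) (_≟ᴾ x)                                  ≡⟨ Pr≡𝔼 (𝒟 n) (_≟ᴾ x) ⟩
  𝔼 (𝒟 n) (𝟙 ∘ (_≟ᴾ x))                             ≡⟨ 𝔼-uniform (allJ n) _ ⟩
  uniformWeight (allJ n) * ∑ (𝟙 ∘ (_≟ᴾ x)) (allJ n)  ≡⟨ cong (uniformWeight (allJ n) *_) (∑-𝟙 (_≟ᴾ x) (allJ n)) ⟩
  uniformWeight (allJ n) * ι (count (_≟ᴾ x) (allJ n)) ≡⟨ cong (λ m → uniformWeight (allJ n) * ι m) (count-allJ x∈J) ⟩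
  uniformWeight (allJ n) * 1ℚ                       ≡⟨ ℚ.*-identityʳ _ ⟩
  uniformWeight (allJ n)                            ∎
  where open ≡-Reasoning

-- The bounds on n and ε only make the instances well-defined measures; the distributional claim holds for every n.
lemma4 : (n : ℕ) → 2 ≤ n → (ε : ℚ) → 0ℚ < ε → ε * (+ (n ^ 4) / 1) < 1ℚ →
    {R : Set} → (P′ : Protocol n R) → (x : Points n) →
    Pr (adversary P′) (is? x) ≡ Pr (𝒟 n) (_≟ᴾ x)
lemma4 n _ ε _ _ P′ x with inJ? x
... | yes x∈J = trans (Pr-adversary-∈J P′ x∈J) (sym (Pr-𝒟-∈J x∈J))
... | no x∉J  = trans (Pr-adversary-∉J P′ x∉J) (sym (Pr-𝒟-∉J x∉J))
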